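{- Let $G$ be a graph. Then \[ |\mathrm{core}(G)|+|\mathrm{corona}(G)|=2\alpha(L_G)+|\mathrm{core}(L_G^c)|+|\mathrm{corona}(L_G^c)|. \]
   Context: All graphs are finite, simple and undirected. $\alpha(H)$ is the maximum size of an independent set of $H$; $\Omega(H)$ is the family of maximum independent sets of $H$; $\mathrm{core}(H)=\bigcap_{S\in\Omega(H)}S$ and $\mathrm{corona}(H)=\bigcup_{S\in\Omega(H)}S$ (for the graph with no vertices, $\alpha=0$ and core and corona are empty). For $S\subseteq V(G)$, $N(S)$ is the set of vertices adjacent to some vertex of $S$. An independent set $I$ is critical if $|I|-|N(I)|=\max\{|J|-|N(J)|:J\subseteq V(G)\}$; a maximum critical independent set is a critical independent set of maximum cardinality. Larson's set $L(G)$ is defined as $L(G)=J\cup N(J)$ for a maximum critical independent set $J$ of $G$ (this is known to be independent of the choice of $J$). Let $L^c(G)=V(G)\setminus L(G)$, $L_G=G[L(G)]$ and $L_G^c=G[L^c(G)]$ (induced subgraphs). -}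

module Defs where

open import Data.Bool using (Bool; true; false; _∧_; _∨_; not; T)
open import Data.Nat using (ℕ; zero; suc; _≤_; _⊔_; _+_; _*_)
open import Data.Fin using (Fin; zero; suc)
open import Data.Vec using (Vec; []; _∷_; lookup; tabulate)
open import Data.List using (List; []; _∷_; map; filter; foldr; _++_)
open import Data.Fin.Subset using (Subset; ∣_∣; _∩_; _∪_; ∁; ⊤; ⊥; _⊆_)
open import Data.Integer as ℤ using (ℤ; +_)
open import Data.Product using (_×_)
open import Relation.Binary.PropositionalEquality using (_≡_)
open import Relation.Nullary.Decidable using (Dec; yes; no)
open import Data.Bool using (_≟_)

record Graph (n : ℕ) : Set where
  field
    adj    : Fin n → Fin n → Bool
    sym    : ∀ u v → adj u v ≡ adj v u
    irrefl : ∀ v → adj v v ≡ false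
open Graph public

allFin : ∀ {n} → (Fin n → Bool) → Bool
allFin {zero}  f = true
allFin {suc n} f = f zero ∧ allFin (λ i → f (suc i))

anyFin : ∀ {n} → (Fin n → Bool) → Bool
anyFin {zero}  f = false
anyFin {suc n} f = f zero ∨ anyFin (λ i → f (suc i))

allSubsets : ∀ n → List (Subset n)
allSubsets zero    = [] ∷ []
allSubsets (suc n) = map (true ∷_) (allSubsets n) ++ map (false ∷_) (allSubsets n)

module _ {n : ℕ} (G : Graph n) where

  isIndep : Subset n → Bool
  isIndep S = allFin λ u → allFin λ v → not (lookup S u ∧ lookup S v ∧ adj G u v)

  Independent : Subset n → Set
  Independent S = T (isIndep S)

  N : Subset n → Subset n
  N S = tabulate λ v → anyFin λ u → lookup S u ∧ adj G u v

  surplus : Subset n → ℤ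
  surplus J = (+ ∣ J ∣) ℤ.- (+ ∣ N J ∣)

  Critical : Subset n → Set
  Critical I = Independent I × (∀ J → surplus J ℤ.≤ surplus I)

  MaxCritical : Subset n → Set
  MaxCritical I = Critical I × (∀ K → Critical K → ∣ K ∣ ≤ ∣ I ∣)

  -- Larson's set L(G) = J ∪ N(J) for a maximum critical independent set J.
  Larson : Subset n → Subset n
  Larson J = J ∪ N J

  -- Independent sets of G[W] are exactly the independent sets of G
  -- contained in W; vertex sets of G[W] are represented as subsets of V(G).

  private
    dec⊆ : Subset n → Subset n → Bool
    dec⊆ S W = allFin λ v → not (lookup S v) ∨ lookup W v

  indepIn : Subset n → List (Subset n)
  indepIn W = filter (λ S → (dec⊆ S W ∧ isIndep S) ≟ true) (allSubsets n)

  α : Subset n → ℕ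
  α W = foldr (λ S m → ∣ S ∣ ⊔ m) 0 (indepIn W)

  Ω : Subset n → List (Subset n)
  Ω W = filter (λ S → Data.Nat._≟_ ∣ S ∣ (α W)) (indepIn W)

  -- core(G[W]) = ⋂ Ω(G[W])  (Ω is never empty: ∅ is independent)
  core : Subset n → Subset n
  core W = foldr _∩_ ⊤ (Ω W)

  corona : Subset n → Subset n
  corona W = foldr _∪_ ⊥ (Ω W)

{-# OPTIONS --safe #-}
module Submission where

-- Write Y = N(J), L = J ∪ Y and R = V ∖ L. Testing the criticality of J against J ∖ N(A)
-- gives Hall's condition ∣ A ∩ Y ∣ ≤ ∣ J ∩ N(A) ∣, so an independent S meets L in at most
-- ∣ J ∣ vertices, while J ∪ T is independent for every independent T ⊆ R. Hence
-- α(G) = α(L) + α(R) with α(L) = ∣ J ∣, a maximum S of G restricts to maximum sets of G[L]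
-- and G[R], and J ∪ T is maximum for every maximum T of G[R]; so core and corona of G[R]
-- are those of G intersected with R.
-- On L, a maximum S is determined by its trace A = S ∩ Y: A is tight (∣ J ∩ N(A) ∣ = ∣ A ∣)
-- and S ∩ J = J ∖ N(A). Tight sets form a lattice, since Hall's condition squeezes the
-- submodular A ↦ ∣ J ∩ N(A) ∣ onto the modular A ↦ ∣ A ∩ Y ∣. So the traces of core and
-- corona on Y are tight, core ∩ J = J ∖ N(corona) and corona ∩ J = J ∖ N(core), and each
-- of ∣ core ∩ J ∣ + ∣ corona ∩ Y ∣ and ∣ corona ∩ J ∣ + ∣ core ∩ Y ∣ equals ∣ J ∣ = α(L).

open import Defs hiding (sym)
open import Algebra.Properties.IdempotentCommutativeMonoid using (∙-distrʳ-∙)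
open import Data.Bool using (Bool; true; false; _∧_; _∨_; not; T)
open import Data.Bool.Properties using (T-≡; T-∧; T-∨)
open import Data.Fin using (Fin; zero; suc)
open import Data.Fin.Subset using (Subset; ∣_∣; _∩_; _∪_; ∁; ⊤; ⊥; ⋂; ⋃; _∈_; _∉_; _⊆_)
open import Data.Fin.Subset.Properties
  using (_∈?_; ⊆-antisym; ⊆-min; p⊆q⇒∣p∣≤∣q∣; p⊂q⇒∣p∣<∣q∣; x∈p∩q⁺; x∈p∩q⁻; x∈p∪q⁺; x∈p∪q⁻; ⊆⊤;
         p⊆p∪q; q⊆p∪q; p∩q⊆p; p∩q⊆q; x∈p⇒x∉∁p; x∈∁p⇒x∉p; x∉p⇒x∈∁p; ∈⊤; ∉⊥;
         ∩-identityʳ; ∪-identityʳ; Empty-unique; ∣⊥∣≡0; ∩-distribˡ-∪; ∩-distribʳ-∪; ∩-idempotentCommutativeMonoid)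
import Data.Integer as ℤ
import Data.Integer.Properties as ℤₚ
open import Data.List using (List; []; _∷_; foldr)
import Data.List as List
open import Data.List.Membership.Propositional using (find; lose) renaming (_∈_ to _∈ₗ_)
open import Data.List.Membership.Propositional.Properties using (∈-filter⁺; ∈-filter⁻; ∈-++⁺ˡ; ∈-++⁺ʳ; ∈-map⁺)
open import Data.List.Relation.Unary.All as All using (All; []; _∷_)
open import Data.List.Relation.Unary.Any using (Any; here; there)
open import Data.Nat using (ℕ; _+_; _*_; _≤_; _⊔_)
open import Data.Nat.Properties
open import Data.Nat.Tactic.RingSolver using (solve-∀)
import Data.Integer.Tactic.RingSolver as ℤ-Solver
open import Data.Product using (_×_; _,_; proj₁; proj₂; ∃; ∃-syntax)
open import Data.Sum using (_⊎_; inj₁; inj₂; [_,_]′)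
open import Data.Unit using (tt)
open import Data.Vec using ([]; _∷_; lookup; tabulate)
open import Data.Vec.Properties using (lookup∘tabulate; []=⇒lookup; lookup⇒[]=)
open import Function using (_∘_; _$_)
open import Function.Bundles using (Equivalence)
open import Relation.Binary.PropositionalEquality as ≡ using (_≡_; refl; cong; cong₂; subst)
open import Relation.Nullary using (¬_; yes; no; contradiction)

open Equivalence using (to; from)

private
  variable
    n : ℕ
    x : Fin n
    p q : Subset n

≤-+-squeeze : ∀ {a b x y} → a ≤ x → b ≤ y → x + y ≤ a + b → x ≤ a × y ≤ b
≤-+-squeeze {a} {b} {x} {y} a≤x b≤y x+y≤a+b =
  +-cancelʳ-≤ y x a (≤-trans x+y≤a+b (+-monoʳ-≤ a b≤y)) ,
  +-cancelˡ-≤ x y b (≤-trans x+y≤a+b (+-monoˡ-≤ b a≤x))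

+a-+b≤+c-+d⇒a+d≤c+b : ∀ {a b c d} → ℤ.+ a ℤ.- ℤ.+ b ℤ.≤ ℤ.+ c ℤ.- ℤ.+ d → a + d ≤ c + b
+a-+b≤+c-+d⇒a+d≤c+b {a} {b} {c} {d} a-b≤c-d = ℤₚ.drop‿+≤+ (begin
  ℤ.+ a ℤ.+ ℤ.+ d                           ≡⟨ cancelˡ (ℤ.+ a) (ℤ.+ b) (ℤ.+ d) ⟨
  (ℤ.+ a ℤ.- ℤ.+ b) ℤ.+ (ℤ.+ b ℤ.+ ℤ.+ d)  ≤⟨ ℤₚ.+-monoˡ-≤ (ℤ.+ b ℤ.+ ℤ.+ d) a-b≤c-d ⟩
  (ℤ.+ c ℤ.- ℤ.+ d) ℤ.+ (ℤ.+ b ℤ.+ ℤ.+ d)  ≡⟨ cancelʳ (ℤ.+ c) (ℤ.+ d) (ℤ.+ b) ⟩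
  ℤ.+ c ℤ.+ ℤ.+ b                           ∎)
  where
  open ℤₚ.≤-Reasoning
  cancelˡ : ∀ x y z → (x ℤ.- y) ℤ.+ (y ℤ.+ z) ≡ x ℤ.+ z
  cancelˡ = ℤ-Solver.solve-∀
  cancelʳ : ∀ x y z → (x ℤ.- y) ℤ.+ (z ℤ.+ y) ≡ x ℤ.+ z
  cancelʳ = ℤ-Solver.solve-∀

T-not⁺ : ∀ {b} → ¬ T b → T (not b)
T-not⁺ {false} _ = tt
T-not⁺ {true}  ¬t = ¬t tt

T-not⁻ : ∀ {b} → T (not b) → ¬ T b
T-not⁻ {false} _ ()

T-allFin⁺ : ∀ {n} {f : Fin n → Bool} → (∀ i → T (f i)) → T (allFin f)
T-allFin⁺ {ℕ.zero}  h = tt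
T-allFin⁺ {ℕ.suc n} h = from T-∧ (h zero , T-allFin⁺ (h ∘ suc))

T-allFin⁻ : ∀ {n} {f : Fin n → Bool} → T (allFin f) → ∀ i → T (f i)
T-allFin⁻ {ℕ.suc n} h zero    = proj₁ (to T-∧ h)
T-allFin⁻ {ℕ.suc n} h (suc i) = T-allFin⁻ (proj₂ (to T-∧ h)) i

T-anyFin⁺ : ∀ {n} {f : Fin n → Bool} i → T (f i) → T (anyFin f)
T-anyFin⁺ zero    t = from T-∨ (inj₁ t)
T-anyFin⁺ (suc i) t = from T-∨ (inj₂ (T-anyFin⁺ i t))

T-anyFin⁻ : ∀ {n} {f : Fin n → Bool} → T (anyFin f) → ∃ λ i → T (f i)
T-anyFin⁻ {ℕ.suc n} h with to T-∨ h
... | inj₁ t = zero , t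
... | inj₂ t = let i , tᵢ = T-anyFin⁻ t in suc i , tᵢ

T-lookup⁺ : x ∈ p → T (lookup p x)
T-lookup⁺ x∈p = from T-≡ ([]=⇒lookup x∈p)

T-lookup⁻ : T (lookup p x) → x ∈ p
T-lookup⁻ {p = p} {x = x} t = lookup⇒[]= x p (to T-≡ t)

∈tabulate⁺ : ∀ {f : Fin n → Bool} → T (f x) → x ∈ tabulate f
∈tabulate⁺ {x = x} {f = f} t = T-lookup⁻ (subst T (≡.sym (lookup∘tabulate f x)) t)

∈tabulate⁻ : ∀ {f : Fin n → Bool} → x ∈ tabulate f → T (f x)
∈tabulate⁻ {x = x} {f = f} x∈ = subst T (lookup∘tabulate f x) (T-lookup⁺ x∈)

∣p∪q∣+∣p∩q∣≡∣p∣+∣q∣ : ∀ (p q : Subset n) → ∣ p ∪ q ∣ + ∣ p ∩ q ∣ ≡ ∣ p ∣ + ∣ q ∣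
∣p∪q∣+∣p∩q∣≡∣p∣+∣q∣ []          []          = refl
∣p∪q∣+∣p∩q∣≡∣p∣+∣q∣ (true ∷ p)  (true ∷ q)  = cong ℕ.suc (begin
  ∣ p ∪ q ∣ + ℕ.suc ∣ p ∩ q ∣  ≡⟨ +-suc _ _ ⟩
  ℕ.suc (∣ p ∪ q ∣ + ∣ p ∩ q ∣) ≡⟨ cong ℕ.suc (∣p∪q∣+∣p∩q∣≡∣p∣+∣q∣ p q) ⟩
  ℕ.suc (∣ p ∣ + ∣ q ∣)         ≡⟨ +-suc _ _ ⟨
  ∣ p ∣ + ℕ.suc ∣ q ∣           ∎)
  where open ≡.≡-Reasoning
∣p∪q∣+∣p∩q∣≡∣p∣+∣q∣ (true ∷ p)  (false ∷ q) = cong ℕ.suc (∣p∪q∣+∣p∩q∣≡∣p∣+∣q∣ p q)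
∣p∪q∣+∣p∩q∣≡∣p∣+∣q∣ (false ∷ p) (true ∷ q)  = ≡.trans (cong ℕ.suc (∣p∪q∣+∣p∩q∣≡∣p∣+∣q∣ p q)) (≡.sym (+-suc _ _))
∣p∪q∣+∣p∩q∣≡∣p∣+∣q∣ (false ∷ p) (false ∷ q) = ∣p∪q∣+∣p∩q∣≡∣p∣+∣q∣ p q

∣p∩q∣+∣p∩∁q∣≡∣p∣ : ∀ (p q : Subset n) → ∣ p ∩ q ∣ + ∣ p ∩ ∁ q ∣ ≡ ∣ p ∣
∣p∩q∣+∣p∩∁q∣≡∣p∣ []          []          = refl
∣p∩q∣+∣p∩∁q∣≡∣p∣ (true ∷ p)  (true ∷ q)  = cong ℕ.suc (∣p∩q∣+∣p∩∁q∣≡∣p∣ p q)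
∣p∩q∣+∣p∩∁q∣≡∣p∣ (true ∷ p)  (false ∷ q) = ≡.trans (+-suc _ _) (cong ℕ.suc (∣p∩q∣+∣p∩∁q∣≡∣p∣ p q))
∣p∩q∣+∣p∩∁q∣≡∣p∣ (false ∷ p) (_ ∷ q)     = ∣p∩q∣+∣p∩∁q∣≡∣p∣ p q

∣p∪q∣≡∣p∣+∣q∣ : ∀ (p q : Subset n) → (∀ {x} → x ∈ p → x ∉ q) → ∣ p ∪ q ∣ ≡ ∣ p ∣ + ∣ q ∣
∣p∪q∣≡∣p∣+∣q∣ {n} p q disjoint = begin
  ∣ p ∪ q ∣                  ≡⟨ +-identityʳ _ ⟨
  ∣ p ∪ q ∣ + 0              ≡⟨ cong (∣ p ∪ q ∣ +_) (∣⊥∣≡0 n) ⟨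
  ∣ p ∪ q ∣ + ∣ ⊥ {n} ∣      ≡⟨ cong (λ s → ∣ p ∪ q ∣ + ∣ s ∣) p∩q≡⊥ ⟨
  ∣ p ∪ q ∣ + ∣ p ∩ q ∣      ≡⟨ ∣p∪q∣+∣p∩q∣≡∣p∣+∣q∣ p q ⟩
  ∣ p ∣ + ∣ q ∣              ∎
  where
  open ≡.≡-Reasoning
  p∩q≡⊥ : p ∩ q ≡ ⊥
  p∩q≡⊥ = Empty-unique λ (_ , x∈p∩q) → let x∈p , x∈q = x∈p∩q⁻ p q x∈p∩q in disjoint x∈p x∈q

∣[p∪q]∩r∣+∣[p∩q]∩r∣≡∣p∩r∣+∣q∩r∣ : ∀ (p q r : Subset n) →
                                  ∣ (p ∪ q) ∩ r ∣ + ∣ (p ∩ q) ∩ r ∣ ≡ ∣ p ∩ r ∣ + ∣ q ∩ r ∣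
∣[p∪q]∩r∣+∣[p∩q]∩r∣≡∣p∩r∣+∣q∩r∣ {n} p q r = begin
  ∣ (p ∪ q) ∩ r ∣ + ∣ (p ∩ q) ∩ r ∣             ≡⟨ cong₂ (λ s t → ∣ s ∣ + ∣ t ∣) (∩-distribʳ-∪ r p q)
                                                     (∙-distrʳ-∙ (∩-idempotentCommutativeMonoid n) r p q) ⟩
  ∣ (p ∩ r) ∪ (q ∩ r) ∣ + ∣ (p ∩ r) ∩ (q ∩ r) ∣ ≡⟨ ∣p∪q∣+∣p∩q∣≡∣p∣+∣q∣ (p ∩ r) (q ∩ r) ⟩
  ∣ p ∩ r ∣ + ∣ q ∩ r ∣                         ∎
  where open ≡.≡-Reasoning

p⊆q⇒∣q∣≤∣p∣⇒q⊆p : p ⊆ q → ∣ q ∣ ≤ ∣ p ∣ → q ⊆ p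
p⊆q⇒∣q∣≤∣p∣⇒q⊆p {p = p} p⊆q ∣q∣≤∣p∣ {x} x∈q with x ∈? p
... | yes x∈p = x∈p
... | no  x∉p = contradiction ∣q∣≤∣p∣ (<⇒≱ (p⊂q⇒∣p∣<∣q∣ (p⊆q , x , x∈q , x∉p)))

module _ {a} {A : Set a} (f : A → ℕ) where

  foldr-⊔-upper : ∀ {y xs} → y ∈ₗ xs → f y ≤ foldr (λ x m → f x ⊔ m) 0 xs
  foldr-⊔-upper {xs = x ∷ xs} (here refl) = m≤m⊔n (f x) _
  foldr-⊔-upper {xs = x ∷ xs} (there y∈xs) = ≤-trans (foldr-⊔-upper y∈xs) (m≤n⊔m (f x) _)

  foldr-⊔-attained : ∀ {y xs} → y ∈ₗ xs → ∃[ z ] z ∈ₗ xs × f z ≡ foldr (λ x m → f x ⊔ m) 0 xs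
  foldr-⊔-attained {xs = x ∷ xs} _ = attained x xs
    where
    attained : ∀ x xs → ∃[ z ] z ∈ₗ x ∷ xs × f z ≡ foldr (λ x m → f x ⊔ m) 0 (x ∷ xs)
    attained x [] = x , here refl , ≡.sym (⊔-identityʳ (f x))
    attained x (x′ ∷ xs) with attained x′ xs | ⊔-sel (f x) (foldr (λ x m → f x ⊔ m) 0 (x′ ∷ xs))
    ... | _ , _    , _  | inj₁ fx⊔m≡fx = x , here refl , ≡.sym fx⊔m≡fx
    ... | z , z∈xs , fz | inj₂ fx⊔m≡m  = z , there z∈xs , ≡.trans fz (≡.sym fx⊔m≡m)

x∈⋂⁺ : ∀ {F : List (Subset n)} → All (x ∈_) F → x ∈ ⋂ F
x∈⋂⁺ []           = ∈⊤
x∈⋂⁺ (x∈p ∷ x∈F) = x∈p∩q⁺ (x∈p , x∈⋂⁺ x∈F)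

x∈⋂⁻ : ∀ (F : List (Subset n)) → x ∈ ⋂ F → All (x ∈_) F
x∈⋂⁻ []      _   = []
x∈⋂⁻ (p ∷ F) x∈ = let x∈p , x∈⋂F = x∈p∩q⁻ p (⋂ F) x∈ in x∈p ∷ x∈⋂⁻ F x∈⋂F

x∈⋃⁺ : ∀ (F : List (Subset n)) → Any (x ∈_) F → x ∈ ⋃ F
x∈⋃⁺ (p ∷ F) (here x∈p)   = p⊆p∪q (⋃ F) x∈p
x∈⋃⁺ (p ∷ F) (there x∈F) = q⊆p∪q p (⋃ F) (x∈⋃⁺ F x∈F)

x∈⋃⁻ : ∀ (F : List (Subset n)) → x ∈ ⋃ F → Any (x ∈_) F
x∈⋃⁻ []      x∈⊥ = contradiction x∈⊥ ∉⊥
x∈⋃⁻ (p ∷ F) x∈ = [ here , there ∘ x∈⋃⁻ F ]′ (x∈p∪q⁻ p (⋃ F) x∈)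

allSubsets-complete : ∀ (p : Subset n) → p ∈ₗ allSubsets n
allSubsets-complete []          = here refl
allSubsets-complete {ℕ.suc n} (true ∷ p)  = ∈-++⁺ˡ (∈-map⁺ (true ∷_) (allSubsets-complete p))
allSubsets-complete {ℕ.suc n} (false ∷ p) =
  ∈-++⁺ʳ (List.map (true ∷_) (allSubsets n)) (∈-map⁺ (false ∷_) (allSubsets-complete p))

-- Neighbourhoods, independent sets, core and corona

module _ (G : Graph n) where

  adj-symmetric : ∀ {u v} → T (adj G u v) → T (adj G v u)
  adj-symmetric {u} {v} = subst T (Graph.sym G u v)

  ∈N⁺ : ∀ {S u v} → u ∈ S → T (adj G u v) → v ∈ N G S
  ∈N⁺ {u = u} u∈S u~v = ∈tabulate⁺ (T-anyFin⁺ u (from T-∧ (T-lookup⁺ u∈S , u~v)))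

  ∈N⁻ : ∀ {S v} → v ∈ N G S → ∃[ u ] u ∈ S × T (adj G u v)
  ∈N⁻ v∈NS = let u , t = T-anyFin⁻ (∈tabulate⁻ v∈NS) ; u∈S , u~v = to T-∧ t in u , T-lookup⁻ u∈S , u~v

  N-mono : p ⊆ q → N G p ⊆ N G q
  N-mono p⊆q v∈Np = let u , u∈p , u~v = ∈N⁻ v∈Np in ∈N⁺ (p⊆q u∈p) u~v

  independent⁺ : ∀ {S} → (∀ {u v} → u ∈ S → v ∈ S → ¬ T (adj G u v)) → Independent G S
  independent⁺ h = T-allFin⁺ λ u → T-allFin⁺ λ v → T-not⁺ λ t →
    let u∈S , t′ = to T-∧ t ; v∈S , u~v = to T-∧ t′ in h {u} {v} (T-lookup⁻ u∈S) (T-lookup⁻ v∈S) u~v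

  independent⁻ : ∀ {S u v} → Independent G S → u ∈ S → v ∈ S → ¬ T (adj G u v)
  independent⁻ {u = u} {v} S-indep u∈S v∈S u~v =
    T-not⁻ (T-allFin⁻ (T-allFin⁻ S-indep u) v) (from T-∧ (T-lookup⁺ u∈S , from T-∧ (T-lookup⁺ v∈S , u~v)))

  independent-⊆ : p ⊆ q → Independent G q → Independent G p
  independent-⊆ p⊆q q-indep = independent⁺ λ u∈p v∈p → independent⁻ q-indep (p⊆q u∈p) (p⊆q v∈p)

  -- The wildcards below stand for the inclusion test S ⊆ W, which is private to Defs.
  ∈indepIn⁺ : ∀ {S W} → S ⊆ W → Independent G S → S ∈ₗ indepIn G W
  ∈indepIn⁺ {S} {W} S⊆W S-indep =
    ∈-filter⁺ (λ S → (_ ∧ isIndep G S) Data.Bool.≟ true) (allSubsets-complete S)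
              (to T-≡ (from T-∧ (T-allFin⁺ included , S-indep)))
    where
    included : ∀ v → T (not (lookup S v) ∨ lookup W v)
    included v with v ∈? S
    ... | yes v∈S = from T-∨ (inj₂ (T-lookup⁺ (S⊆W v∈S)))
    ... | no  v∉S = from T-∨ (inj₁ (T-not⁺ (v∉S ∘ T-lookup⁻)))

  ∈indepIn⁻ : ∀ {S W} → S ∈ₗ indepIn G W → S ⊆ W × Independent G S
  ∈indepIn⁻ {S} {W} S∈ with to T-∧ (from T-≡ (proj₂ (∈-filter⁻ (λ S → (_ ∧ isIndep G S) Data.Bool.≟ true)
                                                                {xs = allSubsets n} S∈)))
  ... | included , S-indep = S⊆W , S-indep
    where
    S⊆W : S ⊆ W
    S⊆W {v} v∈S with to T-∨ (T-allFin⁻ included v)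
    ... | inj₁ v∉S = contradiction (T-lookup⁺ v∈S) (T-not⁻ v∉S)
    ... | inj₂ v∈W = T-lookup⁻ v∈W

  ⊥-independent : Independent G ⊥
  ⊥-independent = independent⁺ λ u∈⊥ _ → contradiction u∈⊥ ∉⊥

  record MaximumIndependent (W S : Subset n) : Set where
    field
      ⊆W          : S ⊆ W
      independent : Independent G S
      maximum     : ∣ S ∣ ≡ α G W

  α-upper : ∀ {S W} → S ⊆ W → Independent G S → ∣ S ∣ ≤ α G W
  α-upper S⊆W S-indep = foldr-⊔-upper ∣_∣ (∈indepIn⁺ S⊆W S-indep)

  α-attained : ∀ W → ∃ (MaximumIndependent W)
  α-attained W =
    let S , S∈ , ∣S∣≡α = foldr-⊔-attained ∣_∣ (∈indepIn⁺ (⊆-min W) ⊥-independent)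
        S⊆W , S-indep = ∈indepIn⁻ S∈
    in S , record { ⊆W = S⊆W ; independent = S-indep ; maximum = ∣S∣≡α }

  ∈Ω⁺ : ∀ {S W} → MaximumIndependent W S → S ∈ₗ Ω G W
  ∈Ω⁺ {S} {W} S-max = ∈-filter⁺ (λ S → ∣ S ∣ Data.Nat.≟ α G W) (∈indepIn⁺ ⊆W independent) maximum
    where open MaximumIndependent S-max

  ∈Ω⁻ : ∀ {S W} → S ∈ₗ Ω G W → MaximumIndependent W S
  ∈Ω⁻ {S} {W} S∈Ω =
    let S∈ , ∣S∣≡α = ∈-filter⁻ (λ S → ∣ S ∣ Data.Nat.≟ α G W) {xs = indepIn G W} S∈Ω
        S⊆W , S-indep = ∈indepIn⁻ S∈
    in record { ⊆W = S⊆W ; independent = S-indep ; maximum = ∣S∣≡α }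

  Ω-nonempty : ∀ W → ∃[ S ] S ∈ₗ Ω G W
  Ω-nonempty W = let S , S-max = α-attained W in S , ∈Ω⁺ S-max

  ∈core⁺ : ∀ {W} → (∀ {S} → MaximumIndependent W S → x ∈ S) → x ∈ core G W
  ∈core⁺ h = x∈⋂⁺ (All.tabulate (h ∘ ∈Ω⁻))

  ∈core⁻ : ∀ {W S} → x ∈ core G W → MaximumIndependent W S → x ∈ S
  ∈core⁻ {W = W} x∈core S-max = All.lookup (x∈⋂⁻ (Ω G W) x∈core) (∈Ω⁺ S-max)

  ∈corona⁺ : ∀ {W S} → MaximumIndependent W S → x ∈ S → x ∈ corona G W
  ∈corona⁺ {W = W} S-max x∈S = x∈⋃⁺ (Ω G W) (lose (∈Ω⁺ S-max) x∈S)

  ∈corona⁻ : ∀ {W} → x ∈ corona G W → ∃[ S ] MaximumIndependent W S × x ∈ S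
  ∈corona⁻ {W = W} x∈corona = let S , S∈Ω , x∈S = find (x∈⋃⁻ (Ω G W) x∈corona) in S , ∈Ω⁻ S∈Ω , x∈S

  core⊆ : ∀ {W} → core G W ⊆ W
  core⊆ {W} x∈core = let S , S-max = α-attained W in MaximumIndependent.⊆W S-max (∈core⁻ x∈core S-max)

  corona⊆ : ∀ {W} → corona G W ⊆ W
  corona⊆ x∈corona = let S , S-max , x∈S = ∈corona⁻ x∈corona in MaximumIndependent.⊆W S-max x∈S

-- A critical independent set J and its Larson set L = J ∪ N(J)

module CriticalIndependentSet {n} (G : Graph n) (J : Subset n) (J-critical : Critical G J) where

  Y L R : Subset n
  Y = N G J
  L = Larson G J
  R = ∁ L

  private
    J-independent : Independent G J
    J-independent = proj₁ J-critical

  J∉Y : x ∈ J → x ∉ Y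
  J∉Y x∈J x∈Y = let u , u∈J , u~x = ∈N⁻ G x∈Y in independent⁻ G J-independent u∈J x∈J u~x

  J∉R : x ∈ J → x ∉ R
  J∉R x∈J = x∈p⇒x∉∁p (p⊆p∪q Y x∈J)

  J≁R : ∀ {u v} → u ∈ J → v ∈ R → ¬ T (adj G u v)
  J≁R u∈J v∈R u~v = x∈∁p⇒x∉p v∈R (q⊆p∪q J Y (∈N⁺ G u∈J u~v))

  ∣p∩L∣≡∣p∩J∣+∣p∩Y∣ : ∀ p → ∣ p ∩ L ∣ ≡ ∣ p ∩ J ∣ + ∣ p ∩ Y ∣
  ∣p∩L∣≡∣p∩J∣+∣p∩Y∣ p = ≡.trans (cong ∣_∣ (∩-distribˡ-∪ p J Y)) (∣p∪q∣≡∣p∣+∣q∣ (p ∩ J) (p ∩ Y) disjoint)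
    where
    disjoint : x ∈ p ∩ J → x ∉ p ∩ Y
    disjoint x∈p∩J x∈p∩Y = J∉Y (proj₂ (x∈p∩q⁻ p J x∈p∩J)) (proj₂ (x∈p∩q⁻ p Y x∈p∩Y))

  ∣p∣≡∣p∩J∣+∣p∩Y∣+∣p∩R∣ : ∀ p → ∣ p ∣ ≡ ∣ p ∩ J ∣ + ∣ p ∩ Y ∣ + ∣ p ∩ R ∣
  ∣p∣≡∣p∩J∣+∣p∩Y∣+∣p∩R∣ p = ≡.trans (≡.sym (∣p∩q∣+∣p∩∁q∣≡∣p∣ p L)) (cong (_+ ∣ p ∩ R ∣) (∣p∩L∣≡∣p∩J∣+∣p∩Y∣ p))

  critical : ∀ K → ∣ K ∣ + ∣ Y ∣ ≤ ∣ J ∣ + ∣ N G K ∣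
  critical K = +a-+b≤+c-+d⇒a+d≤c+b {∣ K ∣} {∣ N G K ∣} {∣ J ∣} {∣ Y ∣} (proj₂ J-critical K)

  -- Hall's condition for matching N(J) into J; the criticality of J is tested against J ∖ N(A).
  hall : ∀ A → ∣ A ∩ Y ∣ ≤ ∣ J ∩ N G A ∣
  hall A = +-cancelˡ-≤ (∣ K ∣ + ∣ N G K ∣) _ _ (begin
    (∣ K ∣ + ∣ N G K ∣) + ∣ A ∩ Y ∣      ≡⟨ +-assoc ∣ K ∣ _ _ ⟩
    ∣ K ∣ + (∣ N G K ∣ + ∣ A ∩ Y ∣)      ≤⟨ +-monoʳ-≤ ∣ K ∣ ∣NK∣+∣A∩Y∣≤∣Y∣ ⟩
    ∣ K ∣ + ∣ Y ∣                         ≤⟨ critical K ⟩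
    ∣ J ∣ + ∣ N G K ∣                     ≡⟨ cong (_+ ∣ N G K ∣) (∣p∩q∣+∣p∩∁q∣≡∣p∣ J (N G A)) ⟨
    (∣ J ∩ N G A ∣ + ∣ K ∣) + ∣ N G K ∣  ≡⟨ +-assoc ∣ J ∩ N G A ∣ _ _ ⟩
    ∣ J ∩ N G A ∣ + (∣ K ∣ + ∣ N G K ∣)  ≡⟨ +-comm ∣ J ∩ N G A ∣ _ ⟩
    (∣ K ∣ + ∣ N G K ∣) + ∣ J ∩ N G A ∣  ∎)
    where
    open ≤-Reasoning
    K : Subset n
    K = J ∩ ∁ (N G A)
    disjoint : x ∈ N G K → x ∉ A ∩ Y
    disjoint x∈NK x∈A∩Y =
      let k , k∈K , k~x = ∈N⁻ G x∈NK ; k∈J , k∉NA = x∈p∩q⁻ J (∁ (N G A)) k∈K in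
      x∈∁p⇒x∉p k∉NA (∈N⁺ G (p∩q⊆p A Y x∈A∩Y) (adj-symmetric G k~x))
    ∣NK∣+∣A∩Y∣≤∣Y∣ : ∣ N G K ∣ + ∣ A ∩ Y ∣ ≤ ∣ Y ∣
    ∣NK∣+∣A∩Y∣≤∣Y∣ = subst (_≤ ∣ Y ∣) (∣p∪q∣≡∣p∣+∣q∣ (N G K) (A ∩ Y) disjoint)
      (p⊆q⇒∣p∣≤∣q∣ λ x∈ → [ N-mono G (p∩q⊆p J _) , p∩q⊆q A Y ]′ (x∈p∪q⁻ (N G K) (A ∩ Y) x∈))

  -- A record rather than a bare inequality, so that A is inferable from a proof of Tight A.
  record Tight (A : Subset n) : Set where
    constructor tight
    field
      bound : ∣ J ∩ N G A ∣ ≤ ∣ A ∩ Y ∣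

  -- A ↦ ∣ J ∩ N(A) ∣ is submodular, A ↦ ∣ A ∩ Y ∣ is modular and hall bounds the latter by
  -- the former; on tight A and B this squeezes both inequalities at A ∪ B and A ∩ B.
  module _ {A B} (A-tight : Tight A) (B-tight : Tight B) where
    private
      NA NB : Subset n
      NA = J ∩ N G A
      NB = J ∩ N G B

      N[A∪B]⊆ : J ∩ N G (A ∪ B) ⊆ NA ∪ NB
      N[A∪B]⊆ x∈ =
        let x∈J , x∈N = x∈p∩q⁻ J _ x∈ ; u , u∈A∪B , u~x = ∈N⁻ G x∈N in
        x∈p∪q⁺ ([ (λ u∈A → inj₁ (x∈p∩q⁺ (x∈J , ∈N⁺ G u∈A u~x))) ,
                   (λ u∈B → inj₂ (x∈p∩q⁺ (x∈J , ∈N⁺ G u∈B u~x))) ]′ (x∈p∪q⁻ A B u∈A∪B))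

      N[A∩B]⊆ : J ∩ N G (A ∩ B) ⊆ NA ∩ NB
      N[A∩B]⊆ x∈ =
        let x∈J , x∈N = x∈p∩q⁻ J _ x∈ in
        x∈p∩q⁺ (x∈p∩q⁺ (x∈J , N-mono G (p∩q⊆p A B) x∈N) , x∈p∩q⁺ (x∈J , N-mono G (p∩q⊆q A B) x∈N))

      squeezed : ∣ NA ∪ NB ∣ ≤ ∣ (A ∪ B) ∩ Y ∣ × ∣ NA ∩ NB ∣ ≤ ∣ (A ∩ B) ∩ Y ∣
      squeezed = ≤-+-squeeze
        (≤-trans (hall (A ∪ B)) (p⊆q⇒∣p∣≤∣q∣ N[A∪B]⊆))
        (≤-trans (hall (A ∩ B)) (p⊆q⇒∣p∣≤∣q∣ N[A∩B]⊆))
        (begin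
          ∣ NA ∪ NB ∣ + ∣ NA ∩ NB ∣              ≡⟨ ∣p∪q∣+∣p∩q∣≡∣p∣+∣q∣ NA NB ⟩
          ∣ NA ∣ + ∣ NB ∣                        ≤⟨ +-mono-≤ (Tight.bound A-tight) (Tight.bound B-tight) ⟩
          ∣ A ∩ Y ∣ + ∣ B ∩ Y ∣                  ≡⟨ ∣[p∪q]∩r∣+∣[p∩q]∩r∣≡∣p∩r∣+∣q∩r∣ A B Y ⟨
          ∣ (A ∪ B) ∩ Y ∣ + ∣ (A ∩ B) ∩ Y ∣      ∎)
        where open ≤-Reasoning

    tight-∪ : Tight (A ∪ B)
    tight-∪ = tight $ ≤-trans (p⊆q⇒∣p∣≤∣q∣ N[A∪B]⊆) (proj₁ squeezed)

    tight-∩ : Tight (A ∩ B)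
    tight-∩ = tight $ ≤-trans (p⊆q⇒∣p∣≤∣q∣ N[A∩B]⊆) (proj₂ squeezed)

    tight-N-∩ : NA ∩ NB ⊆ J ∩ N G (A ∩ B)
    tight-N-∩ = p⊆q⇒∣q∣≤∣p∣⇒q⊆p N[A∩B]⊆ (≤-trans (proj₂ squeezed) (hall (A ∩ B)))

  private
    tight-∩⋂ : ∀ {A} F → Tight A → All Tight F → Tight (A ∩ ⋂ F)
    tight-∩⋂ {A} []      A-tight []                = subst Tight (≡.sym (∩-identityʳ A)) A-tight
    tight-∩⋂     (B ∷ F) A-tight (B-tight ∷ F-tight) = tight-∩ A-tight (tight-∩⋂ F B-tight F-tight)

    tight-∪⋃ : ∀ {A} F → Tight A → All Tight F → Tight (A ∪ ⋃ F)
    tight-∪⋃ {A} []      A-tight []                = subst Tight (≡.sym (∪-identityʳ A)) A-tight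
    tight-∪⋃     (B ∷ F) A-tight (B-tight ∷ F-tight) = tight-∪ A-tight (tight-∪⋃ F B-tight F-tight)

    tight-N-∩⋂ : ∀ {A} F → Tight A → All Tight F →
                 x ∈ J ∩ N G A → All (λ S → x ∈ J ∩ N G S) F → x ∈ J ∩ N G (A ∩ ⋂ F)
    tight-N-∩⋂ {A = A} [] _ [] x∈NA [] = subst (λ B → _ ∈ J ∩ N G B) (≡.sym (∩-identityʳ A)) x∈NA
    tight-N-∩⋂ (B ∷ F) A-tight (B-tight ∷ F-tight) x∈NA (x∈NB ∷ x∈NF) =
      tight-N-∩ A-tight (tight-∩⋂ F B-tight F-tight) (x∈p∩q⁺ (x∈NA , tight-N-∩⋂ F B-tight F-tight x∈NB x∈NF))

  tight-⋂ : ∀ {S} F → S ∈ₗ F → All Tight F → Tight (⋂ F)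
  tight-⋂ (A ∷ F) _ (A-tight ∷ F-tight) = tight-∩⋂ F A-tight F-tight

  tight-⋃ : ∀ {S} F → S ∈ₗ F → All Tight F → Tight (⋃ F)
  tight-⋃ (A ∷ F) _ (A-tight ∷ F-tight) = tight-∪⋃ F A-tight F-tight

  tight-N-⋂ : ∀ {S} F → S ∈ₗ F → All Tight F → All (λ S → x ∈ J ∩ N G S) F → x ∈ J ∩ N G (⋂ F)
  tight-N-⋂ (A ∷ F) _ (A-tight ∷ F-tight) (x∈NA ∷ x∈NF) = tight-N-∩⋂ F A-tight F-tight x∈NA x∈NF

  module _ {S} (S-independent : Independent G S) where
    private
      disjoint : x ∈ S ∩ J → x ∉ J ∩ N G S
      disjoint x∈S∩J x∈J∩NS =
        let u , u∈S , u~x = ∈N⁻ G (p∩q⊆q J (N G S) x∈J∩NS) in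
        independent⁻ G S-independent u∈S (p∩q⊆p S J x∈S∩J) u~x

      S∩J∪J∩NS⊆J : (S ∩ J) ∪ (J ∩ N G S) ⊆ J
      S∩J∪J∩NS⊆J x∈ = [ p∩q⊆q S J , p∩q⊆p J (N G S) ]′ (x∈p∪q⁻ (S ∩ J) (J ∩ N G S) x∈)

      ∣S∩J∣+∣J∩NS∣≤∣J∣ : ∣ S ∩ J ∣ + ∣ J ∩ N G S ∣ ≤ ∣ J ∣
      ∣S∩J∣+∣J∩NS∣≤∣J∣ = subst (_≤ ∣ J ∣) (∣p∪q∣≡∣p∣+∣q∣ (S ∩ J) (J ∩ N G S) disjoint) (p⊆q⇒∣p∣≤∣q∣ S∩J∪J∩NS⊆J)

      ∣S∩L∣≤∣S∩J∣+∣J∩NS∣ : ∣ S ∩ L ∣ ≤ ∣ S ∩ J ∣ + ∣ J ∩ N G S ∣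
      ∣S∩L∣≤∣S∩J∣+∣J∩NS∣ = ≤-trans (≤-reflexive (∣p∩L∣≡∣p∩J∣+∣p∩Y∣ S)) (+-monoʳ-≤ ∣ S ∩ J ∣ (hall S))

    ∣S∩L∣≤∣J∣ : ∣ S ∩ L ∣ ≤ ∣ J ∣
    ∣S∩L∣≤∣J∣ = ≤-trans ∣S∩L∣≤∣S∩J∣+∣J∩NS∣ ∣S∩J∣+∣J∩NS∣≤∣J∣

    module _ (saturated : ∣ J ∣ ≤ ∣ S ∩ L ∣) where

      saturated⇒tight : Tight S
      saturated⇒tight = tight $ +-cancelˡ-≤ ∣ S ∩ J ∣ _ _ $ begin
        ∣ S ∩ J ∣ + ∣ J ∩ N G S ∣  ≤⟨ ∣S∩J∣+∣J∩NS∣≤∣J∣ ⟩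
        ∣ J ∣                      ≤⟨ saturated ⟩
        ∣ S ∩ L ∣                  ≡⟨ ∣p∩L∣≡∣p∩J∣+∣p∩Y∣ S ⟩
        ∣ S ∩ J ∣ + ∣ S ∩ Y ∣      ∎
        where open ≤-Reasoning

      saturated⇒J⊆S∪NS : J ⊆ S ∪ N G S
      saturated⇒J⊆S∪NS x∈J =
        x∈p∪q⁺ ([ inj₁ ∘ p∩q⊆p S J , inj₂ ∘ p∩q⊆q J (N G S) ]′ (x∈p∪q⁻ (S ∩ J) (J ∩ N G S) (J⊆ x∈J)))
        where
        J⊆ : J ⊆ (S ∩ J) ∪ (J ∩ N G S)
        J⊆ = p⊆q⇒∣q∣≤∣p∣⇒q⊆p S∩J∪J∩NS⊆J $ begin
          ∣ J ∣                              ≤⟨ ≤-trans saturated ∣S∩L∣≤∣S∩J∣+∣J∩NS∣ ⟩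
          ∣ S ∩ J ∣ + ∣ J ∩ N G S ∣          ≡⟨ ∣p∪q∣≡∣p∣+∣q∣ (S ∩ J) (J ∩ N G S) disjoint ⟨
          ∣ (S ∩ J) ∪ (J ∩ N G S) ∣          ∎
          where open ≤-Reasoning

  J∪S-independent : ∀ {S} → S ⊆ R → Independent G S → Independent G (J ∪ S)
  J∪S-independent {S} S⊆R S-independent =
    independent⁺ G λ u∈ v∈ → edge-free (x∈p∪q⁻ J S u∈) (x∈p∪q⁻ J S v∈)
    where
    edge-free : ∀ {u v} → u ∈ J ⊎ u ∈ S → v ∈ J ⊎ v ∈ S → ¬ T (adj G u v)
    edge-free (inj₁ u∈J) (inj₁ v∈J) = independent⁻ G J-independent u∈J v∈J
    edge-free (inj₁ u∈J) (inj₂ v∈S) = J≁R u∈J (S⊆R v∈S)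
    edge-free (inj₂ u∈S) (inj₁ v∈J) = J≁R v∈J (S⊆R u∈S) ∘ adj-symmetric G
    edge-free (inj₂ u∈S) (inj₂ v∈S) = independent⁻ G S-independent u∈S v∈S

  ∣J∪S∣≡∣J∣+∣S∣ : ∀ {S} → S ⊆ R → ∣ J ∪ S ∣ ≡ ∣ J ∣ + ∣ S ∣
  ∣J∪S∣≡∣J∣+∣S∣ {S} S⊆R = ∣p∪q∣≡∣p∣+∣q∣ J S λ x∈J x∈S → J∉R x∈J (S⊆R x∈S)

  α-L : α G L ≡ ∣ J ∣
  α-L = ≤-antisym α-L≤∣J∣ (α-upper G (p⊆p∪q {p = J} Y) J-independent)
    where
    open ≤-Reasoning
    α-L≤∣J∣ : α G L ≤ ∣ J ∣
    α-L≤∣J∣ with α-attained G L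
    ... | S , record { ⊆W = S⊆L ; independent = S-independent ; maximum = ∣S∣≡α } = begin
      α G L      ≡⟨ ∣S∣≡α ⟨
      ∣ S ∣      ≤⟨ p⊆q⇒∣p∣≤∣q∣ (λ x∈S → x∈p∩q⁺ (x∈S , S⊆L x∈S)) ⟩
      ∣ S ∩ L ∣  ≤⟨ ∣S∩L∣≤∣J∣ {S} S-independent ⟩
      ∣ J ∣      ∎

  α-⊤ : α G ⊤ ≡ ∣ J ∣ + α G R
  α-⊤ with α-attained G ⊤ | α-attained G R
  ... | S , record { independent = S-independent ; maximum = ∣S∣≡α⊤ }
      | T , record { ⊆W = T⊆R ; independent = T-independent ; maximum = ∣T∣≡αR } = ≤-antisym (begin
        α G ⊤                    ≡⟨ ∣S∣≡α⊤ ⟨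
        ∣ S ∣                    ≡⟨ ∣p∩q∣+∣p∩∁q∣≡∣p∣ S L ⟨
        ∣ S ∩ L ∣ + ∣ S ∩ R ∣    ≤⟨ +-mono-≤ (∣S∩L∣≤∣J∣ {S} S-independent)
                                     (α-upper G (p∩q⊆q S R) (independent-⊆ G (p∩q⊆p S R) S-independent)) ⟩
        ∣ J ∣ + α G R            ∎) (begin
        ∣ J ∣ + α G R            ≡⟨ cong (∣ J ∣ +_) ∣T∣≡αR ⟨
        ∣ J ∣ + ∣ T ∣            ≡⟨ ∣J∪S∣≡∣J∣+∣S∣ T⊆R ⟨
        ∣ J ∪ T ∣                ≤⟨ α-upper G (⊆⊤ {p = J ∪ T}) (J∪S-independent T⊆R T-independent) ⟩
        α G ⊤                    ∎)
    where open ≤-Reasoning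

  module _ {S} (S-maximum : MaximumIndependent G ⊤ S) where
    open MaximumIndependent S-maximum using (independent; maximum)

    private
      S∩R-independent : Independent G (S ∩ R)
      S∩R-independent = independent-⊆ G (p∩q⊆p S R) independent

      squeezed : ∣ J ∣ ≤ ∣ S ∩ L ∣ × α G R ≤ ∣ S ∩ R ∣
      squeezed = ≤-+-squeeze (∣S∩L∣≤∣J∣ {S} independent) (α-upper G (p∩q⊆q S R) S∩R-independent) $ begin
        ∣ J ∣ + α G R          ≡⟨ α-⊤ ⟨
        α G ⊤                  ≡⟨ maximum ⟨
        ∣ S ∣                  ≡⟨ ∣p∩q∣+∣p∩∁q∣≡∣p∣ S L ⟨
        ∣ S ∩ L ∣ + ∣ S ∩ R ∣  ∎
        where open ≤-Reasoning

    maximum-∩R : MaximumIndependent G R (S ∩ R)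
    maximum-∩R = record
      { ⊆W          = p∩q⊆q S R
      ; independent = S∩R-independent
      ; maximum     = ≤-antisym (α-upper G (p∩q⊆q S R) S∩R-independent) (proj₂ squeezed)
      }

    maximum-tight : Tight S
    maximum-tight = saturated⇒tight {S} independent (proj₁ squeezed)

    maximum-J⊆S∪NS : J ⊆ S ∪ N G S
    maximum-J⊆S∪NS = saturated⇒J⊆S∪NS {S} independent (proj₁ squeezed)

  maximum-J∪ : ∀ {S} → MaximumIndependent G R S → MaximumIndependent G ⊤ (J ∪ S)
  maximum-J∪ {S} record { ⊆W = S⊆R ; independent = S-independent ; maximum = ∣S∣≡αR } = record
    { ⊆W          = ⊆⊤
    ; independent = J∪S-independent S⊆R S-independent
    ; maximum     = ≡.trans (∣J∪S∣≡∣J∣+∣S∣ S⊆R) (≡.trans (cong (∣ J ∣ +_) ∣S∣≡αR) (≡.sym α-⊤))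
    }

  core-R : core G R ≡ core G ⊤ ∩ R
  core-R = ⊆-antisym
    (λ x∈ → x∈p∩q⁺ (∈core⁺ G (λ S-maximum → p∩q⊆p _ R (∈core⁻ G x∈ (maximum-∩R S-maximum))) , core⊆ G x∈))
    (λ x∈ → let x∈core , x∈R = x∈p∩q⁻ (core G ⊤) R x∈ in
      ∈core⁺ G λ S-maximum → [ (λ x∈J → contradiction x∈R (J∉R x∈J)) , (λ x∈S → x∈S) ]′
                               (x∈p∪q⁻ J _ (∈core⁻ G x∈core (maximum-J∪ S-maximum))))

  corona-R : corona G R ≡ corona G ⊤ ∩ R
  corona-R = ⊆-antisym
    (λ x∈ → let S , S-maximum , x∈S = ∈corona⁻ G x∈ in
      x∈p∩q⁺ (∈corona⁺ G (maximum-J∪ S-maximum) (q⊆p∪q J S x∈S) , corona⊆ G x∈))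
    (λ x∈ → let x∈corona , x∈R = x∈p∩q⁻ (corona G ⊤) R x∈ ; S , S-maximum , x∈S = ∈corona⁻ G x∈corona in
      ∈corona⁺ G (maximum-∩R S-maximum) (x∈p∩q⁺ (x∈S , x∈R)))

  private
    Ω-tight : All Tight (Ω G ⊤)
    Ω-tight = All.tabulate (maximum-tight ∘ ∈Ω⁻ G)

  core-tight : Tight (core G ⊤)
  core-tight = tight-⋂ (Ω G ⊤) (proj₂ (Ω-nonempty G ⊤)) Ω-tight

  corona-tight : Tight (corona G ⊤)
  corona-tight = tight-⋃ (Ω G ⊤) (proj₂ (Ω-nonempty G ⊤)) Ω-tight

  core∩J : core G ⊤ ∩ J ≡ J ∩ ∁ (N G (corona G ⊤))
  core∩J = ⊆-antisym
    (λ x∈ → let x∈core , x∈J = x∈p∩q⁻ (core G ⊤) J x∈ in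
      x∈p∩q⁺ (x∈J , x∉p⇒x∈∁p λ x∈N →
        let u , u∈corona , u~x = ∈N⁻ G x∈N ; S , S-maximum , u∈S = ∈corona⁻ G {W = ⊤} u∈corona in
        independent⁻ G (MaximumIndependent.independent S-maximum) u∈S (∈core⁻ G x∈core S-maximum) u~x))
    (λ x∈ → let x∈J , x∉N = x∈p∩q⁻ J _ x∈ in
      x∈p∩q⁺ (∈core⁺ G (λ S-maximum →
        [ (λ x∈S → x∈S) , (λ x∈NS → contradiction (N-mono G (∈corona⁺ G S-maximum) x∈NS) (x∈∁p⇒x∉p x∉N)) ]′
        (x∈p∪q⁻ _ _ (maximum-J⊆S∪NS S-maximum x∈J))) , x∈J))

  corona∩J : corona G ⊤ ∩ J ≡ J ∩ ∁ (N G (core G ⊤))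
  corona∩J = ⊆-antisym
    (λ x∈ → let x∈corona , x∈J = x∈p∩q⁻ (corona G ⊤) J x∈ ; S , S-maximum , x∈S = ∈corona⁻ G {W = ⊤} x∈corona in
      x∈p∩q⁺ (x∈J , x∉p⇒x∈∁p λ x∈N →
        let u , u∈core , u~x = ∈N⁻ G x∈N in
        independent⁻ G (MaximumIndependent.independent S-maximum) (∈core⁻ G u∈core S-maximum) x∈S u~x))
    (λ x∈ → let x∈J , x∉N = x∈p∩q⁻ J _ x∈ in x∈p∩q⁺ (∈corona x∈J (x∈∁p⇒x∉p x∉N) , x∈J))
    where
    -- An x ∈ J outside every maximum independent set lies in every J ∩ N(S), hence in J ∩ N(core).
    ∈corona : x ∈ J → x ∉ N G (core G ⊤) → x ∈ corona G ⊤
    ∈corona {x} x∈J x∉N with x ∈? corona G ⊤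
    ... | yes x∈corona = x∈corona
    ... | no  x∉corona = contradiction (p∩q⊆q J _ x∈J∩N) x∉N
      where
      x∈J∩NS : ∀ {S} → S ∈ₗ Ω G ⊤ → x ∈ J ∩ N G S
      x∈J∩NS S∈Ω = let S-maximum = ∈Ω⁻ G S∈Ω in
        x∈p∩q⁺ (x∈J , [ (λ x∈S → contradiction (∈corona⁺ G S-maximum x∈S) x∉corona) , (λ x∈NS → x∈NS) ]′
                         (x∈p∪q⁻ _ _ (maximum-J⊆S∪NS S-maximum x∈J)))
      x∈J∩N : x ∈ J ∩ N G (core G ⊤)
      x∈J∩N = tight-N-⋂ (Ω G ⊤) (proj₂ (Ω-nonempty G ⊤)) Ω-tight (All.tabulate x∈J∩NS)

  ∣J∩∁NA∣+∣A∩Y∣≡∣J∣ : ∀ {A} → Tight A → ∣ J ∩ ∁ (N G A) ∣ + ∣ A ∩ Y ∣ ≡ ∣ J ∣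
  ∣J∩∁NA∣+∣A∩Y∣≡∣J∣ {A} (tight A-bound) = begin
    ∣ J ∩ ∁ (N G A) ∣ + ∣ A ∩ Y ∣      ≡⟨ cong (∣ J ∩ ∁ (N G A) ∣ +_) (≤-antisym (hall A) A-bound) ⟩
    ∣ J ∩ ∁ (N G A) ∣ + ∣ J ∩ N G A ∣  ≡⟨ +-comm ∣ J ∩ ∁ (N G A) ∣ _ ⟩
    ∣ J ∩ N G A ∣ + ∣ J ∩ ∁ (N G A) ∣  ≡⟨ ∣p∩q∣+∣p∩∁q∣≡∣p∣ J (N G A) ⟩
    ∣ J ∣                              ∎
    where open ≡.≡-Reasoning

  ∣core∣+∣corona∣≡2α[L]+∣core[R]∣+∣corona[R]∣ :
    ∣ core G ⊤ ∣ + ∣ corona G ⊤ ∣ ≡ 2 * α G L + ∣ core G R ∣ + ∣ corona G R ∣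
  ∣core∣+∣corona∣≡2α[L]+∣core[R]∣+∣corona[R]∣ = begin
    ∣ C ∣ + ∣ U ∣
      ≡⟨ cong₂ _+_ (∣p∣≡∣p∩J∣+∣p∩Y∣+∣p∩R∣ C) (∣p∣≡∣p∩J∣+∣p∩Y∣+∣p∩R∣ U) ⟩
    (∣ C ∩ J ∣ + ∣ C ∩ Y ∣ + ∣ C ∩ R ∣) + (∣ U ∩ J ∣ + ∣ U ∩ Y ∣ + ∣ U ∩ R ∣)
      ≡⟨ regroup (∣ C ∩ J ∣) (∣ C ∩ Y ∣) (∣ C ∩ R ∣) (∣ U ∩ J ∣) (∣ U ∩ Y ∣) (∣ U ∩ R ∣) ⟩
    (∣ C ∩ J ∣ + ∣ U ∩ Y ∣) + (∣ U ∩ J ∣ + ∣ C ∩ Y ∣) + ∣ C ∩ R ∣ + ∣ U ∩ R ∣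
      ≡⟨ cong₂ (λ c u → (∣ c ∣ + ∣ U ∩ Y ∣) + (∣ u ∣ + ∣ C ∩ Y ∣) + ∣ C ∩ R ∣ + ∣ U ∩ R ∣) core∩J corona∩J ⟩
    (∣ J ∩ ∁ (N G U) ∣ + ∣ U ∩ Y ∣) + (∣ J ∩ ∁ (N G C) ∣ + ∣ C ∩ Y ∣) + ∣ C ∩ R ∣ + ∣ U ∩ R ∣
      ≡⟨ cong₂ (λ j j′ → j + j′ + ∣ C ∩ R ∣ + ∣ U ∩ R ∣)
               (∣J∩∁NA∣+∣A∩Y∣≡∣J∣ corona-tight) (∣J∩∁NA∣+∣A∩Y∣≡∣J∣ core-tight) ⟩
    ∣ J ∣ + ∣ J ∣ + ∣ C ∩ R ∣ + ∣ U ∩ R ∣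
      ≡⟨ cong (λ j → ∣ J ∣ + j + ∣ C ∩ R ∣ + ∣ U ∩ R ∣) (+-identityʳ ∣ J ∣) ⟨
    2 * ∣ J ∣ + ∣ C ∩ R ∣ + ∣ U ∩ R ∣
      ≡⟨ cong₂ (λ c u → 2 * ∣ J ∣ + ∣ c ∣ + ∣ u ∣) core-R corona-R ⟨
    2 * ∣ J ∣ + ∣ core G R ∣ + ∣ corona G R ∣
      ≡⟨ cong (λ j → 2 * j + ∣ core G R ∣ + ∣ corona G R ∣) α-L ⟨
    2 * α G L + ∣ core G R ∣ + ∣ corona G R ∣
      ∎
    where
    open ≡.≡-Reasoning
    C U : Subset n
    C = core G ⊤
    U = corona G ⊤
    regroup : ∀ a b c d e f → (a + b + c) + (d + e + f) ≡ (a + e) + (d + b) + c + f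
    regroup = solve-∀

mainTheorem3 : ∀ {n : ℕ} (G : Graph n) (J : Subset n) → MaxCritical G J →
    ∣ core G ⊤ ∣ + ∣ corona G ⊤ ∣
      ≡ 2 * α G (Larson G J) + ∣ core G (∁ (Larson G J)) ∣ + ∣ corona G (∁ (Larson G J)) ∣
mainTheorem3 G J (J-critical , _) =
  CriticalIndependentSet.∣core∣+∣corona∣≡2α[L]+∣core[R]∣+∣corona[R]∣ G J J-critical
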